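{- For $n\geq 2$, $|\hat{\mathcal{B}}_n(121)|=\sum_{k=1}^{n-1}k^{n-k-1}$.
   Context: An endofunction of size $n$ is a word $x=x_1\cdots x_n$ with entries in $\{1,\dots,n\}$; it is a Cayley permutation if it contains every integer between $1$ and $\max(x)$. Let $\mathrm{Ascbot}(x)=\{1\}\cup\{i:1\leq i\leq n-1,\ x_i<x_{i+1}\}$ and $\mathrm{Nub}(x)$ the set of indices $i$ such that $x_i$ is the leftmost occurrence of its value. A revised ascent sequence of length $n$ is a Cayley permutation $x$ of length $n$ with $\mathrm{Ascbot}(x)=\mathrm{Nub}(x)$. For Cayley permutations $x$ and $\sigma=\sigma_1\cdots\sigma_k$, $x$ contains $\sigma$ if there are indices $i_1<\cdots<i_k$ such that for all $s,t$: $x_{i_s}<x_{i_t}\iff\sigma_s<\sigma_t$ and $x_{i_s}=x_{i_t}\iff\sigma_s=\sigma_t$; otherwise $x$ avoids $\sigma$. $\hat{\mathcal{B}}_n(\sigma)$ is the set of revised ascent sequences of length $n$ avoiding $\sigma$. -}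

module Defs where

open import Data.Nat using (ℕ; zero; suc; _+_; _∸_; _^_; _≡ᵇ_; _<ᵇ_; _⊔_)
open import Data.Bool using (Bool; true; false; _∧_; _∨_; not; if_then_else_)
open import Data.List using (List; []; _∷_; map; concatMap; length; filter;
  applyUpTo; upTo; take; lookup; zip)
open import Data.Bool.ListAction using (all; any)
open import Data.Nat.ListAction using (sum)
open import Relation.Nullary.Decidable using (Dec; yes; no)
open import Data.Bool.Properties using (T?)

-- Words are lists of naturals; positions are 1-based as in the paper.

-- x_i for 1 ≤ i ≤ length x (0 outside range; never used there)
at : List ℕ → ℕ → ℕ
at []       _             = 0
at (a ∷ _)  1             = a
at (_ ∷ xs) (suc (suc i)) = at xs (suc i)
at (_ ∷ _)  zero          = 0

oneTo : ℕ → List ℕ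
oneTo m = applyUpTo suc m

elem : ℕ → List ℕ → Bool
elem v xs = any (λ a → v ≡ᵇ a) xs

wordsOver : List ℕ → ℕ → List (List ℕ)
wordsOver alph zero    = [] ∷ []
wordsOver alph (suc k) = concatMap (λ a → map (a ∷_) (wordsOver alph k)) alph

endofunctions : ℕ → List (List ℕ)
endofunctions n = wordsOver (oneTo n) n

maxW : List ℕ → ℕ
maxW []       = 0
maxW (a ∷ xs) = a ⊔ maxW xs

isCayley : List ℕ → Bool
isCayley x = all (λ v → elem v x) (oneTo (maxW x))

inAscbot : List ℕ → ℕ → Bool
inAscbot x i = (i ≡ᵇ 1) ∨ ((i <ᵇ length x) ∧ (at x i <ᵇ at x (suc i)))

inNub : List ℕ → ℕ → Bool
inNub x i = not (elem (at x i) (take (i ∸ 1) x))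

ascbotEqNub : List ℕ → Bool
ascbotEqNub x = all (λ i → (inAscbot x i ∧ inNub x i) ∨ (not (inAscbot x i) ∧ not (inNub x i)))
                    (oneTo (length x))

isRevisedAscentSeq : List ℕ → Bool
isRevisedAscentSeq x = isCayley x ∧ ascbotEqNub x

subseqs : ℕ → List ℕ → List (List ℕ)
subseqs zero    _        = [] ∷ []
subseqs (suc k) []       = []
subseqs (suc k) (a ∷ xs) = map (a ∷_) (subseqs k xs) ++' subseqs (suc k) xs
  where
  _++'_ : List (List ℕ) → List (List ℕ) → List (List ℕ)
  []       ++' ys = ys
  (z ∷ zs) ++' ys = z ∷ (zs ++' ys)

_⇔ᵇ_ : Bool → Bool → Bool
a ⇔ᵇ b = (a ∧ b) ∨ (not a ∧ not b)

orderIso : List ℕ → List ℕ → Bool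
orderIso y σ = (length y ≡ᵇ length σ) ∧
  all (λ s → all (λ t →
        ((at y s <ᵇ at y t) ⇔ᵇ (at σ s <ᵇ at σ t)) ∧
        ((at y s ≡ᵇ at y t) ⇔ᵇ (at σ s ≡ᵇ at σ t)))
      (oneTo (length σ))) (oneTo (length σ))

contains : List ℕ → List ℕ → Bool
contains x σ = any (λ y → orderIso y σ) (subseqs (length σ) x)

avoids : List ℕ → List ℕ → Bool
avoids x σ = not (contains x σ)

hatB : ℕ → List ℕ → List (List ℕ)
hatB n σ = filter (λ x → T? (isRevisedAscentSeq x ∧ avoids x σ)) (endofunctions n)

rhs : ℕ → ℕ
rhs n = sum (applyUpTo (λ i → suc i ^ (n ∸ suc i ∸ 1)) (n ∸ 1))

-- Let x = a w be a revised ascent sequence. The first occurrence of max(x) is a nub, hence an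
-- ascent bottom, which is impossible except at position 1; so a = max(x). If x also avoids 121,
-- a value c ≠ a occurs only once: its first occurrence is a nub, hence followed by some d > c,
-- and a second c would give the pattern c d c. So every entry other than a is immediately
-- followed by a larger one, and x = a B₁ a B₂ ⋯ a B_k a with increasing blocks B_i that
-- partition {1, …, a − 1} and k = n − a; conversely every such word qualifies. There are
-- k^(a − 1) of them, and Σ_a (n − a)^(a − 1) = Σ_k k^(n − k − 1).
-- Counted letter by letter, the block words satisfy a recurrence in the state (U, b) of values
-- still to be placed and last value of the open block, solved by Π_{u ∈ U} (k if u > b, else k − 1).

module Submission where

open import Defs
open import Data.Nat using (ℕ; _≤_)
open import Data.List using (List; _∷_; []; length)
open import Relation.Binary.PropositionalEquality using (_≡_)

open import Data.Bool using (Bool; true; false; T; not; _∧_; if_then_else_)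
open import Data.Bool.ListAction using (all)
open import Data.Bool.Properties using (T-∧; T-≡; T?)
open import Data.Empty using (⊥-elim)
open import Data.List using (_++_; map; take; filter; null; concatMap; applyUpTo)
open import Data.List.Membership.Propositional using (_∈_; _∉_; find; lose)
open import Data.List.Membership.Propositional.Properties
  using (∈-++⁻; ∈-++⁺ˡ; ∈-++⁺ʳ; ∈-map⁺; ∈-map⁻; ∈-applyUpTo⁺; ∈-applyUpTo⁻; ∈-filter⁺; ∈-filter⁻)
open import Data.List.Properties
  using (length-++; ++-assoc; ∷-injective; ∷-injectiveˡ; ∷-injectiveʳ; filter-++; filter-accept; filter-reject;
         filter-all; map-cong-local; length-applyUpTo; applyUpTo-∷ʳ; map-applyUpTo)
open import Data.List.Relation.Binary.Sublist.Propositional using (_⊆_; []; _∷_; _∷ʳ_; minimum; from∈)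
open import Data.List.Relation.Binary.Sublist.Propositional.Properties using (++⁺ˡ; Any-resp-⊆)
open import Data.List.Relation.Unary.All using (All; []; _∷_)
import Data.List.Relation.Unary.All as All
open import Data.List.Relation.Unary.All.Properties using (all⁺; all⁻)
import Data.List.Relation.Unary.All.Properties as Allₚ
open import Data.List.Relation.Unary.AllPairs using (AllPairs; []; _∷_)
import Data.List.Relation.Unary.AllPairs.Properties as AllPairsₚ
open import Data.List.Relation.Unary.Any using (here; there)
import Data.List.Relation.Unary.Any as Any
open import Data.List.Relation.Unary.Any.Properties using (any⁺; any⁻)
open import Data.Nat
  using (zero; suc; pred; _+_; _*_; _^_; _∸_; _<_; z<s; s<s; z≤n; s≤s; _≟_; _<?_; _≤?_; _<ᵇ_; _≡ᵇ_)
open import Data.Nat.ListAction using (sum; product)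
open import Data.Nat.ListAction.Properties using (sum-++)
open import Data.Nat.Properties
open import Data.Nat.Tactic.RingSolver using (solve-∀)
open import Data.Product using (∃₂; ∃-syntax; _×_; _,_; proj₁; proj₂)
open import Data.Product.Function.NonDependent.Propositional using (_×-⇔_)
open import Data.Sum using (_⊎_; inj₁; inj₂)
import Data.Sum as Sum
open import Function using (_⇔_; mk⇔; Equivalence; _∘_)
open import Function.Properties.Equivalence using () renaming (trans to ⇔-trans; sym to ⇔-sym)
open import Relation.Binary.PropositionalEquality
  using (_≢_; refl; sym; trans; cong; cong₂; subst; ≢-sym; module ≡-Reasoning)
open import Relation.Nullary using (Reflects; ofʸ; ofⁿ; proof; ¬_; ¬?; yes; no)
open import Relation.Nullary.Decidable using (dec-true; dec-false)
open import Relation.Nullary.Reflects using (fromEquivalence)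

open ≡-Reasoning

≡ᵇ-reflects-≡ : ∀ m n → Reflects (m ≡ n) (m ≡ᵇ n)
≡ᵇ-reflects-≡ m n = proof (m ≟ n)

≡ᵇ-true : ∀ {m n} → m ≡ n → (m ≡ᵇ n) ≡ true
≡ᵇ-true = dec-true (_ ≟ _)

≡ᵇ-false : ∀ {m n} → m ≢ n → (m ≡ᵇ n) ≡ false
≡ᵇ-false = dec-false (_ ≟ _)

<ᵇ-true : ∀ {m n} → m < n → (m <ᵇ n) ≡ true
<ᵇ-true = dec-true (_ <? _)

<ᵇ-false : ∀ {m n} → ¬ m < n → (m <ᵇ n) ≡ false
<ᵇ-false = dec-false (_ <? _)

T-not⇔¬T : ∀ {b} → T (not b) ⇔ (¬ T b)
T-not⇔¬T {false} = mk⇔ (λ _ ()) _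
T-not⇔¬T {true}  = mk⇔ (λ ()) (λ ¬t → ¬t _)

T-⇔ᵇ : ∀ {a b} → T (a ⇔ᵇ b) ⇔ (a ≡ b)
T-⇔ᵇ {false} {false} = mk⇔ (λ _ → refl) _
T-⇔ᵇ {false} {true}  = mk⇔ (λ ()) (λ ())
T-⇔ᵇ {true}  {false} = mk⇔ (λ ()) (λ ())
T-⇔ᵇ {true}  {true}  = mk⇔ (λ _ → refl) _

T-⇔ᵇ-true : ∀ {b} → T (b ⇔ᵇ true) → T b
T-⇔ᵇ-true {true} _ = _

T-⇔⇒≡ : ∀ {a b} → T a ⇔ T b → a ≡ b
T-⇔⇒≡ {false} {false} _ = refl
T-⇔⇒≡ {false} {true}  h = ⊥-elim (Equivalence.from h _)
T-⇔⇒≡ {true}  {false} h = ⊥-elim (Equivalence.to h _)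
T-⇔⇒≡ {true}  {true}  _ = refl

elem⇔∈ : ∀ {v xs} → T (elem v xs) ⇔ v ∈ xs
elem⇔∈ = mk⇔ (Any.map (≡ᵇ⇒≡ _ _) ∘ any⁻ _ _) (any⁺ _ ∘ Any.map (≡⇒≡ᵇ _ _))

elem-reflects-∈ : ∀ v xs → Reflects (v ∈ xs) (elem v xs)
elem-reflects-∈ v xs = fromEquivalence (Equivalence.to elem⇔∈) (Equivalence.from elem⇔∈)

elem-true : ∀ {v xs} → v ∈ xs → elem v xs ≡ true
elem-true v∈ = Equivalence.to T-≡ (Equivalence.from elem⇔∈ v∈)

elem-false : ∀ {v xs} → v ∉ xs → elem v xs ≡ false
elem-false {v} {xs} v∉ with elem v xs | elem-reflects-∈ v xs
... | false | _      = refl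
... | true  | ofʸ v∈ = ⊥-elim (v∉ v∈)

∈-oneTo⁻ : ∀ {v m} → v ∈ oneTo m → 0 < v × v ≤ m
∈-oneTo⁻ p with _ , i<m , refl ← ∈-applyUpTo⁻ suc p = z<s , i<m

∈-oneTo⁺ : ∀ {v m} → 0 < v → v ≤ m → v ∈ oneTo m
∈-oneTo⁺ {suc v} _ v<m = ∈-applyUpTo⁺ suc v<m

∈-oneTo-pred⁻ : ∀ {v a} → v ∈ oneTo (pred a) → 0 < v × v < a
∈-oneTo-pred⁻ {a = suc a} v∈ with 0<v , v≤a ← ∈-oneTo⁻ v∈ = 0<v , s≤s v≤a

∈-oneTo-pred⁺ : ∀ {v a} → 0 < v → v < a → v ∈ oneTo (pred a)
∈-oneTo-pred⁺ 0<v v<a = ∈-oneTo⁺ 0<v (<⇒≤pred v<a)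

oneTo-sorted : ∀ n → AllPairs _<_ (oneTo n)
oneTo-sorted n = AllPairsₚ.applyUpTo⁺₁ suc n (λ i<j _ → s<s i<j)

maxW-ub : ∀ {c x} → c ∈ x → c ≤ maxW x
maxW-ub {x = a ∷ x} (here refl) = m≤m⊔n a (maxW x)
maxW-ub {x = a ∷ x} (there c∈x) = ≤-trans (maxW-ub c∈x) (m≤n⊔m a (maxW x))

maxW-∈ : ∀ a x → maxW (a ∷ x) ∈ a ∷ x
maxW-∈ a []      = here (⊔-identityʳ a)
maxW-∈ a (b ∷ x) with ⊔-sel a (maxW (b ∷ x))
... | inj₁ eq = here eq
... | inj₂ eq = there (subst (_∈ b ∷ x) (sym eq) (maxW-∈ b x))

maxW-lub : ∀ {a} x → (∀ {c} → c ∈ x → c ≤ a) → maxW x ≤ a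
maxW-lub []      _   = z≤n
maxW-lub (c ∷ x) ub = ⊔-lub (ub (here refl)) (maxW-lub x (ub ∘ there))

[]≢++∷ : ∀ (q : List ℕ) {c r} → [] ≢ q ++ c ∷ r
[]≢++∷ []      ()
[]≢++∷ (_ ∷ _) ()

first-occurrence : ∀ {c : ℕ} {xs} → c ∈ xs → ∃[ q₁ ] ∃[ q₂ ] (xs ≡ q₁ ++ c ∷ q₂ × c ∉ q₁)
first-occurrence {c} {x ∷ xs} c∈ with c ≟ x
... | yes refl = [] , xs , refl , λ ()
first-occurrence {c} {x ∷ xs} (here c≡x) | no c≢x = ⊥-elim (c≢x c≡x)
first-occurrence {c} {x ∷ xs} (there c∈) | no c≢x with q₁ , q₂ , refl , c∉q₁ ← first-occurrence c∈ =
  x ∷ q₁ , q₂ , refl , λ { (here c≡x) → c≢x c≡x ; (there c∈q₁) → c∉q₁ c∈q₁ }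

split-at : ∀ (x : List ℕ) {j} → j < length x →
           ∃[ pre ] ∃[ c ] ∃[ post ] (x ≡ pre ++ c ∷ post × length pre ≡ j)
split-at (c ∷ x) {zero}  _ = [] , c , x , refl , refl
split-at (a ∷ x) {suc j} (s<s j<n) with pre , c , post , refl , refl ← split-at x j<n =
  a ∷ pre , c , post , refl , refl

∈-wordsOver⁻ : ∀ {A : List ℕ} k {x} → x ∈ wordsOver A k → All (_∈ A) x
∈-wordsOver⁻         zero    (here refl) = []
∈-wordsOver⁻ {A} (suc k) {x} x∈ = go A (λ b∈ → b∈) x∈
  where
  go : ∀ B → (∀ {b} → b ∈ B → b ∈ A) →
       x ∈ concatMap (λ a → map (a ∷_) (wordsOver A k)) B → All (_∈ A) x
  go (b ∷ B) B⊆A x∈ with ∈-++⁻ (map (b ∷_) (wordsOver A k)) x∈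
  ... | inj₂ x∈′ = go B (B⊆A ∘ there) x∈′
  ... | inj₁ x∈′ with w , w∈ , refl ← ∈-map⁻ (b ∷_) x∈′ = B⊆A (here refl) ∷ ∈-wordsOver⁻ k w∈

-- Subsequences and the pattern 121

append-unique : ∀ {A : Set} {_⊕_ : List A → List A → List A} →
                (∀ ys → [] ⊕ ys ≡ ys) → (∀ z zs ys → (z ∷ zs) ⊕ ys ≡ z ∷ (zs ⊕ ys)) →
                ∀ xs ys → xs ⊕ ys ≡ xs ++ ys
append-unique ⊕-[] ⊕-∷ []       ys = ⊕-[] ys
append-unique ⊕-[] ⊕-∷ (z ∷ zs) ys = trans (⊕-∷ z zs ys) (cong (z ∷_) (append-unique ⊕-[] ⊕-∷ zs ys))

-- `subseqs` appends with a local copy of `_++_` that cannot be named: `_⊕_` is solved to it by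
-- unification once `specialise` has made both arguments variables (the annotations pick the
-- list constructor among the overloaded `_∷_`).
subseqs-suc : ∀ k a xs → subseqs (suc k) (a ∷ xs) ≡ map (a ∷_) (subseqs k xs) ++ subseqs (suc k) xs
subseqs-suc k a xs = specialise (append-unique (λ _ → refl) (λ _ _ _ → refl))
  where
  _⊕_ : List (List ℕ) → List (List ℕ) → List (List ℕ)
  _⊕_ = _
  specialise : (∀ M R → M ⊕ R ≡ M ++ R) →
               subseqs (suc k) (a ∷ xs) ≡ map (a ∷_) (subseqs k xs) ++ subseqs (suc k) xs
  specialise eq with map {B = List ℕ} (_∷_ {A = ℕ} a) (subseqs k xs) | subseqs (suc k) xs
  ... | M | R = eq M R

∈-subseqs⁻ : ∀ k xs {ys} → ys ∈ subseqs k xs → ys ⊆ xs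
∈-subseqs⁻ zero    xs       (here refl) = minimum xs
∈-subseqs⁻ (suc k) (a ∷ xs) p rewrite subseqs-suc k a xs with ∈-++⁻ (map (a ∷_) (subseqs k xs)) p
... | inj₁ q with _ , zs∈ , refl ← ∈-map⁻ (a ∷_) q = refl ∷ ∈-subseqs⁻ k xs zs∈
... | inj₂ q = a ∷ʳ ∈-subseqs⁻ (suc k) xs q

∈-subseqs⁺ : ∀ {ys xs} → ys ⊆ xs → ys ∈ subseqs (length ys) xs
∈-subseqs⁺ {[]}     _ = here refl
∈-subseqs⁺ {y ∷ ys} {a ∷ xs} (.a ∷ʳ s) =
  subst (_ ∈_) (sym (subseqs-suc (length ys) a xs)) (∈-++⁺ʳ _ (∈-subseqs⁺ s))
∈-subseqs⁺ {y ∷ ys} {.y ∷ xs} (refl ∷ s) =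
  subst (_ ∈_) (sym (subseqs-suc (length ys) y xs)) (∈-++⁺ˡ (∈-map⁺ (y ∷_) (∈-subseqs⁺ s)))

∷-⊆-split : ∀ {x : ℕ} {xs ys} → x ∷ xs ⊆ ys →
            ∃[ ys₁ ] ∃[ ys₂ ] (ys ≡ ys₁ ++ x ∷ ys₂ × xs ⊆ ys₂)
∷-⊆-split (y ∷ʳ s) with ys₁ , ys₂ , refl , s′ ← ∷-⊆-split s = y ∷ ys₁ , ys₂ , refl , s′
∷-⊆-split (refl ∷ s) = [] , _ , refl , s

σ121 : List ℕ
σ121 = 1 ∷ 2 ∷ 1 ∷ []

-- The body of `orderIso`, named so that `all⁺` can be applied to the rows of the comparison table.
entryIso : List ℕ → List ℕ → ℕ → ℕ → Bool
entryIso y σ s t =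
  ((at y s <ᵇ at y t) ⇔ᵇ (at σ s <ᵇ at σ t)) ∧ ((at y s ≡ᵇ at y t) ⇔ᵇ (at σ s ≡ᵇ at σ t))

orderIso-121⁻ : ∀ {y} → T (orderIso y σ121) → ∃₂ λ p q → p < q × y ≡ p ∷ q ∷ p ∷ []
orderIso-121⁻ {p ∷ q ∷ r ∷ []} iso
  with row₁ ∷ _ ← all⁺ (λ s → all (entryIso (p ∷ q ∷ r ∷ []) σ121 s) (oneTo 3)) (oneTo 3) iso
  with _ ∷ iso₁₂ ∷ iso₁₃ ∷ [] ← all⁺ (entryIso (p ∷ q ∷ r ∷ []) σ121 1) (oneTo 3) row₁
  with refl ← ≡ᵇ⇒≡ p r (T-⇔ᵇ-true (proj₂ (Equivalence.to T-∧ iso₁₃)))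
  = p , q , <ᵇ⇒< p q (T-⇔ᵇ-true (proj₁ (Equivalence.to T-∧ iso₁₂))) , refl

orderIso-121⁺ : ∀ {p q} → p < q → T (orderIso (p ∷ q ∷ p ∷ []) σ121)
orderIso-121⁺ {p} {q} p<q
  rewrite <ᵇ-true p<q | <ᵇ-false (<⇒≯ p<q) | <ᵇ-false (n≮n p) | <ᵇ-false (n≮n q)
        | ≡ᵇ-true {p} refl | ≡ᵇ-true {q} refl | ≡ᵇ-false (<⇒≢ p<q) | ≡ᵇ-false (≢-sym (<⇒≢ p<q)) = _

Contains121 : List ℕ → Set
Contains121 x = ∃₂ λ p q → p < q × p ∷ q ∷ p ∷ [] ⊆ x

contains-121⇔ : ∀ x → T (contains x σ121) ⇔ Contains121 x
contains-121⇔ x = mk⇔ to from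
  where
  to : T (contains x σ121) → Contains121 x
  to c with y , y∈ , iso ← find (any⁻ _ _ c) with p , q , p<q , refl ← orderIso-121⁻ {y} iso =
    p , q , p<q , ∈-subseqs⁻ 3 x y∈
  from : Contains121 x → T (contains x σ121)
  from (p , q , p<q , s) = any⁺ _ (lose (∈-subseqs⁺ s) (orderIso-121⁺ p<q))

avoids-121⇔ : ∀ x → T (avoids x σ121) ⇔ (¬ Contains121 x)
avoids-121⇔ x = mk⇔ (λ a c → Equivalence.to T-not⇔¬T a (Equivalence.from (contains-121⇔ x) c))
                    (λ ¬c → Equivalence.from T-not⇔¬T (¬c ∘ Equivalence.to (contains-121⇔ x)))

-- Cayley permutations and Ascbot = Nub

Cayley : List ℕ → Set
Cayley x = ∀ {v} → v ∈ oneTo (maxW x) → v ∈ x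

isCayley⇔ : ∀ x → T (isCayley x) ⇔ Cayley x
isCayley⇔ x = mk⇔ (λ c {v} v∈ → Equivalence.to elem⇔∈ (All.lookup (all⁺ _ _ c) v∈))
                  (λ c → all⁻ _ (All.tabulate (λ v∈ → Equivalence.from elem⇔∈ (c v∈))))

ascbotAt : List ℕ → ℕ → List ℕ → Bool
ascbotAt []      _ _       = true
ascbotAt (_ ∷ _) _ []      = false
ascbotAt (_ ∷ _) c (d ∷ _) = c <ᵇ d

at-++ : ∀ pre c post → at (pre ++ c ∷ post) (suc (length pre)) ≡ c
at-++ []          c post = refl
at-++ (_ ∷ [])    c post = refl
at-++ (_ ∷ b ∷ pre) c post = at-++ (b ∷ pre) c post

at-++-next : ∀ pre c d post → at (pre ++ c ∷ d ∷ post) (suc (suc (length pre))) ≡ d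
at-++-next []        c d post = refl
at-++-next (_ ∷ pre) c d post = at-++-next pre c d post

take-length-++ : ∀ (pre rest : List ℕ) → take (length pre) (pre ++ rest) ≡ pre
take-length-++ []        rest = refl
take-length-++ (a ∷ pre) rest = cong (a ∷_) (take-length-++ pre rest)

length-++-∷ : ∀ (pre : List ℕ) c post → length (pre ++ c ∷ post) ≡ suc (length pre + length post)
length-++-∷ pre c post = trans (length-++ pre) (+-suc (length pre) (length post))

inNub-++ : ∀ pre c post → inNub (pre ++ c ∷ post) (suc (length pre)) ≡ not (elem c pre)
inNub-++ pre c post rewrite at-++ pre c post | take-length-++ pre (c ∷ post) = refl

inAscbot-++ : ∀ pre c post → inAscbot (pre ++ c ∷ post) (suc (length pre)) ≡ ascbotAt pre c post
inAscbot-++ []        c post = refl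
inAscbot-++ (a ∷ pre) c []
  rewrite length-++-∷ pre c [] | +-identityʳ (length pre) | <ᵇ-false (n≮n (length pre)) = refl
inAscbot-++ (a ∷ pre) c (d ∷ post)
  rewrite length-++-∷ pre c (d ∷ post) | <ᵇ-true (m<m+n (length pre) (z<s {length post}))
        | at-++ pre c (d ∷ post) | at-++-next pre c d post = refl

AscbotEqNub : List ℕ → Set
AscbotEqNub x = ∀ pre c post → x ≡ pre ++ c ∷ post → ascbotAt pre c post ≡ not (elem c pre)

ascbotEqNub⇔ : ∀ x → T (ascbotEqNub x) ⇔ AscbotEqNub x
ascbotEqNub⇔ x = mk⇔ to from
  where
  to : T (ascbotEqNub x) → AscbotEqNub x
  to h pre c post refl = begin
    ascbotAt pre c post            ≡⟨ inAscbot-++ pre c post ⟨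
    inAscbot x (suc (length pre))  ≡⟨ Equivalence.to T-⇔ᵇ (All.lookup (all⁺ _ _ h) i∈) ⟩
    inNub x (suc (length pre))     ≡⟨ inNub-++ pre c post ⟩
    not (elem c pre)               ∎
    where
    i∈ : suc (length pre) ∈ oneTo (length x)
    i∈ = ∈-oneTo⁺ z<s (subst (suc (length pre) ≤_) (sym (length-++-∷ pre c post)) (s≤s (m≤m+n _ _)))
  agree : AscbotEqNub x → ∀ {i} → i ∈ oneTo (length x) → T (inAscbot x i ⇔ᵇ inNub x i)
  agree h i∈ with ∈-oneTo⁻ i∈
  ... | z<s {j} , j<n with pre , c , post , refl , refl ← split-at x j<n =
    Equivalence.from T-⇔ᵇ (trans (inAscbot-++ pre c post) (trans (h pre c post refl) (sym (inNub-++ pre c post))))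
  from : AscbotEqNub x → T (ascbotEqNub x)
  from h = all⁻ _ (All.tabulate (agree h))

RevisedAvoiding121 : List ℕ → Set
RevisedAvoiding121 x = (Cayley x × AscbotEqNub x) × ¬ Contains121 x

revisedAvoiding121ᵇ : List ℕ → Bool
revisedAvoiding121ᵇ x = isRevisedAscentSeq x ∧ avoids x σ121

revisedAvoiding121⇔ : ∀ x → T (revisedAvoiding121ᵇ x) ⇔ RevisedAvoiding121 x
revisedAvoiding121⇔ x = ⇔-trans T-∧ (⇔-trans T-∧ (isCayley⇔ x ×-⇔ ascbotEqNub⇔ x) ×-⇔ avoids-121⇔ x)

-- Block form

data HeadAbove (b : ℕ) : List ℕ → Set where
  head> : ∀ {d r} → b < d → HeadAbove b (d ∷ r)

-- w = B₁ M B₂ M ⋯ B_k M, where the blocks B_i are increasing and together use each value of U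
-- exactly once, and B₁ continues an increasing run ending in b; b = 0 means that no run is open,
-- which works because all values are positive.
record Blocks (M : ℕ) (U : List ℕ) (b : ℕ) (w : List ℕ) : Set where
  field
    entry   : ∀ {c} → c ∈ w → c ≡ M ⊎ c ∈ U
    covers  : ∀ {v} → v ∈ U → v ∈ w
    pending : 0 < b → HeadAbove b w
    ascends : ∀ q c r → w ≡ q ++ c ∷ r → c ≢ M → HeadAbove c r
    once    : ∀ q c r → w ≡ q ++ c ∷ r → c ≢ M → c ∉ q ++ r

record ValueSet (M : ℕ) (U : List ℕ) : Set where
  field
    sorted   : AllPairs _<_ U
    positive : All (0 <_) U
    below    : All (_< M) U

_without_ : List ℕ → ℕ → List ℕ
U without c = filter (λ u → ¬? (u ≟ c)) U

∈-without⁻ : ∀ {v c} U → v ∈ U without c → v ∈ U × v ≢ c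
∈-without⁻ U = ∈-filter⁻ (λ u → ¬? (u ≟ _))

∈-without⁺ : ∀ {v c U} → v ∈ U → v ≢ c → v ∈ U without c
∈-without⁺ = ∈-filter⁺ (λ u → ¬? (u ≟ _))

valueSet-without : ∀ {M U} c → ValueSet M U → ValueSet M (U without c)
valueSet-without c vs = record
  { sorted   = AllPairsₚ.filter⁺ _ (ValueSet.sorted vs)
  ; positive = Allₚ.filter⁺ _ (ValueSet.positive vs)
  ; below    = Allₚ.filter⁺ _ (ValueSet.below vs)
  }

without-head : ∀ {u} U → All (u <_) U → (u ∷ U) without u ≡ U
without-head {u} U u<U =
  trans (filter-reject (λ v → ¬? (v ≟ u)) (λ u≢u → u≢u refl))
        (filter-all (λ v → ¬? (v ≟ u)) (All.map (≢-sym ∘ <⇒≢) u<U))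

without-∷ : ∀ {u c} U → u ≢ c → (u ∷ U) without c ≡ u ∷ (U without c)
without-∷ {c = c} U = filter-accept (λ v → ¬? (v ≟ c))

length-without : ∀ {c} U → AllPairs _<_ U → c ∈ U → suc (length (U without c)) ≡ length U
length-without (u ∷ U) (u<U ∷ _)      (here refl) = cong (suc ∘ length) (without-head U u<U)
length-without (u ∷ U) (u<U ∷ sorted) (there c∈U) =
  trans (cong (suc ∘ length) (without-∷ U (<⇒≢ (All.lookup u<U c∈U)))) (cong suc (length-without U sorted c∈U))

valueSet-oneTo-pred : ∀ a → ValueSet a (oneTo (pred a))
valueSet-oneTo-pred a = record
  { sorted   = oneTo-sorted (pred a)
  ; positive = All.tabulate (proj₁ ∘ ∈-oneTo-pred⁻ {a = a})
  ; below    = All.tabulate (proj₂ ∘ ∈-oneTo-pred⁻ {a = a})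
  }

module _ {M : ℕ} where

  blocks-[] : Blocks M [] 0 []
  blocks-[] = record
    { entry   = λ ()
    ; covers  = λ ()
    ; pending = λ ()
    ; ascends = λ q _ _ eq _ → ⊥-elim ([]≢++∷ q eq)
    ; once    = λ q _ _ eq _ → ⊥-elim ([]≢++∷ q eq)
    }

  blocks-[]⁻ : ∀ {U b} → Blocks M U b [] → b ≡ 0 × U ≡ []
  blocks-[]⁻ {[]}    {zero}  _  = refl , refl
  blocks-[]⁻ {[]}    {suc b} bl with () ← Blocks.pending bl z<s
  blocks-[]⁻ {u ∷ U}         bl with () ← Blocks.covers bl (here refl)

  blocks-M∷ : ∀ {U b w} → b < M → Blocks M U 0 w → Blocks M U b (M ∷ w)
  blocks-M∷ {U} {b} {w} b<M bl = record
    { entry   = λ { (here refl) → inj₁ refl ; (there c∈w) → entry c∈w }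
    ; covers  = there ∘ covers
    ; pending = λ _ → head> b<M
    ; ascends = ascends′
    ; once    = once′
    }
    where
    open Blocks bl
    ascends′ : ∀ q c r → M ∷ w ≡ q ++ c ∷ r → c ≢ M → HeadAbove c r
    ascends′ []      c r refl c≢M = ⊥-elim (c≢M refl)
    ascends′ (_ ∷ q) c r eq   c≢M = ascends q c r (∷-injectiveʳ eq) c≢M
    once′ : ∀ q c r → M ∷ w ≡ q ++ c ∷ r → c ≢ M → c ∉ q ++ r
    once′ []      c r refl c≢M _           = c≢M refl
    once′ (_ ∷ q) c r eq   c≢M (here refl) = c≢M (sym (∷-injectiveˡ eq))
    once′ (_ ∷ q) c r eq   c≢M (there c∈)  = once q c r (∷-injectiveʳ eq) c≢M c∈

  blocks-M∷⁻ : ∀ {U b w} → All (_< M) U → Blocks M U b (M ∷ w) → Blocks M U 0 w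
  blocks-M∷⁻ {U} {b} {w} below bl = record
    { entry   = entry ∘ there
    ; covers  = covers′
    ; pending = λ ()
    ; ascends = λ q c r eq → ascends (M ∷ q) c r (cong (M ∷_) eq)
    ; once    = λ q c r eq c≢M c∈ → once (M ∷ q) c r (cong (M ∷_) eq) c≢M (there c∈)
    }
    where
    open Blocks bl
    covers′ : ∀ {v} → v ∈ U → v ∈ w
    covers′ v∈U with covers v∈U
    ... | here refl = ⊥-elim (n≮n M (All.lookup below v∈U))
    ... | there v∈w = v∈w

  blocks-∷ : ∀ {U b c w} → ValueSet M U → c ∈ U → b < c → Blocks M (U without c) c w → Blocks M U b (c ∷ w)
  blocks-∷ {U} {b} {c} {w} vs c∈U b<c bl = record
    { entry   = entry′
    ; covers  = covers′
    ; pending = λ _ → head> b<c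
    ; ascends = ascends′
    ; once    = once′
    }
    where
    open Blocks bl
    c∉w : c ∉ w
    c∉w c∈w with entry c∈w
    ... | inj₁ refl = n≮n c (All.lookup (ValueSet.below vs) c∈U)
    ... | inj₂ c∈U∖c = proj₂ (∈-without⁻ U c∈U∖c) refl
    entry′ : ∀ {v} → v ∈ c ∷ w → v ≡ M ⊎ v ∈ U
    entry′ (here refl) = inj₂ c∈U
    entry′ (there v∈w) = Sum.map₂ (proj₁ ∘ ∈-without⁻ U) (entry v∈w)
    covers′ : ∀ {v} → v ∈ U → v ∈ c ∷ w
    covers′ {v} v∈U with v ≟ c
    ... | yes refl = here refl
    ... | no v≢c   = there (covers (∈-without⁺ v∈U v≢c))
    ascends′ : ∀ q v r → c ∷ w ≡ q ++ v ∷ r → v ≢ M → HeadAbove v r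
    ascends′ []      v r refl _   = pending (All.lookup (ValueSet.positive vs) c∈U)
    ascends′ (_ ∷ q) v r eq   v≢M = ascends q v r (∷-injectiveʳ eq) v≢M
    once′ : ∀ q v r → c ∷ w ≡ q ++ v ∷ r → v ≢ M → v ∉ q ++ r
    once′ []      v r refl _   = c∉w
    once′ (_ ∷ q) v r eq   v≢M (here refl) =
      c∉w (subst (_∈ w) (sym (∷-injectiveˡ eq))
                 (subst (_ ∈_) (sym (∷-injectiveʳ eq)) (∈-++⁺ʳ q (here refl))))
    once′ (_ ∷ q) v r eq   v≢M (there v∈) = once q v r (∷-injectiveʳ eq) v≢M v∈

  blocks-∷⁻ : ∀ {U b c w} → ValueSet M U → c ≢ M → Blocks M U b (c ∷ w) →
              c ∈ U × b < c × Blocks M (U without c) c w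
  blocks-∷⁻ {U} {b} {c} {w} vs c≢M bl = c∈U , b<c pending , record
    { entry   = entry′
    ; covers  = covers′
    ; pending = λ _ → ascends [] c w refl c≢M
    ; ascends = λ q v r eq → ascends (c ∷ q) v r (cong (c ∷_) eq)
    ; once    = λ q v r eq v≢M v∈ → once (c ∷ q) v r (cong (c ∷_) eq) v≢M (there v∈)
    }
    where
    open Blocks bl
    c∈U : c ∈ U
    c∈U with entry (here refl)
    ... | inj₁ c≡M = ⊥-elim (c≢M c≡M)
    ... | inj₂ c∈U = c∈U
    b<c : ∀ {b} → (0 < b → HeadAbove b (c ∷ w)) → b < c
    b<c {zero}  _       = All.lookup (ValueSet.positive vs) c∈U
    b<c {suc _} pending with head> b<c ← pending z<s = b<c
    c∉w : c ∉ w
    c∉w = once [] c w refl c≢M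
    entry′ : ∀ {v} → v ∈ w → v ≡ M ⊎ v ∈ U without c
    entry′ v∈w = Sum.map₂ (λ v∈U → ∈-without⁺ v∈U (λ { refl → c∉w v∈w })) (entry (there v∈w))
    covers′ : ∀ {v} → v ∈ U without c → v ∈ w
    covers′ v∈U∖c with ∈-without⁻ U v∈U∖c
    ... | v∈U , v≢c with covers v∈U
    ...   | here v≡c  = ⊥-elim (v≢c v≡c)
    ...   | there v∈w = v∈w

blocksᵇ : ℕ → List ℕ → ℕ → List ℕ → Bool
blocksᵇ M U b []      = (b ≡ᵇ 0) ∧ null U
blocksᵇ M U b (c ∷ w) =
  if c ≡ᵇ M then blocksᵇ M U 0 w
  else if (b <ᵇ c) ∧ elem c U then blocksᵇ M (U without c) c w
  else false

blocksᵇ-[] : ∀ {M U b} → T (blocksᵇ M U b []) → b ≡ 0 × U ≡ []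
blocksᵇ-[] {U = []} {zero} _ = refl , refl

blocksᵇ⇔Blocks : ∀ {M U b} w → ValueSet M U → b < M → T (blocksᵇ M U b w) ⇔ Blocks M U b w
blocksᵇ⇔Blocks [] _ _ = mk⇔ to from
  where
  to : ∀ {M U b} → T (blocksᵇ M U b []) → Blocks M U b []
  to {M} {U} {b} h with refl , refl ← blocksᵇ-[] {M} {U} {b} h = blocks-[]
  from : ∀ {M U b} → Blocks M U b [] → T (blocksᵇ M U b [])
  from {M} bl with refl , refl ← blocks-[]⁻ {M} bl = _
blocksᵇ⇔Blocks {M} {U} {b} (c ∷ w) vs b<M with c ≡ᵇ M | ≡ᵇ-reflects-≡ c M
... | true  | ofʸ refl =
  let open Equivalence (blocksᵇ⇔Blocks w vs (m<n⇒0<n b<M))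
  in mk⇔ (blocks-M∷ b<M ∘ to) (from ∘ blocks-M∷⁻ (ValueSet.below vs))
... | false | ofⁿ c≢M with b <ᵇ c | <ᵇ-reflects-< b c | elem c U | elem-reflects-∈ c U
...   | true  | ofʸ b<c | true  | ofʸ c∈U =
  let open Equivalence (blocksᵇ⇔Blocks w (valueSet-without c vs) (All.lookup (ValueSet.below vs) c∈U))
  in mk⇔ (blocks-∷ vs c∈U b<c ∘ to) (from ∘ proj₂ ∘ proj₂ ∘ blocks-∷⁻ vs c≢M)
...   | true  | ofʸ _   | false | ofⁿ c∉U = mk⇔ (λ ()) (c∉U ∘ proj₁ ∘ blocks-∷⁻ vs c≢M)
...   | false | ofⁿ b≮c | _     | _       = mk⇔ (λ ()) (b≮c ∘ proj₁ ∘ proj₂ ∘ blocks-∷⁻ vs c≢M)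

-- 121-avoiding revised ascent sequences are the block words

nub-ascends : ∀ {x pre c post} → AscbotEqNub x → x ≡ pre ++ c ∷ post → pre ≢ [] → c ∉ pre →
              HeadAbove c post
nub-ascends {pre = []}          _   _  pre≢[] _ = ⊥-elim (pre≢[] refl)
nub-ascends {pre = _ ∷ _} {c} {post} asc eq _ c∉pre = ascent (trans (asc _ c post eq) (cong not (elem-false c∉pre)))
  where
  ascent : ∀ {a pre post} → ascbotAt (a ∷ pre) c post ≡ true → HeadAbove c post
  ascent {post = d ∷ _} c<ᵇd = head> (<ᵇ⇒< c d (Equivalence.from T-≡ c<ᵇd))

nub-once : ∀ {x pre c post} → AscbotEqNub x → ¬ Contains121 x →
           x ≡ pre ++ c ∷ post → pre ≢ [] → c ∉ pre → c ∉ post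
nub-once {pre = pre} {c} asc no121 refl pre≢[] c∉pre c∈post with nub-ascends asc refl pre≢[] c∉pre | c∈post
... | head> c<d | here c≡d  = <-irrefl c≡d c<d
... | head> {d} c<d | there c∈r = no121 (c , d , c<d , ++⁺ˡ pre (refl ∷ refl ∷ from∈ c∈r))

repeat-is-head : ∀ {a w pre c post} → AscbotEqNub (a ∷ w) → ¬ Contains121 (a ∷ w) →
                 a ∷ w ≡ pre ++ c ∷ post → c ∈ pre → c ≡ a
repeat-is-head {a} {c = c} asc no121 eq c∈pre with c ≟ a
... | yes c≡a = c≡a
... | no c≢a with q₁ , q₂ , refl , c∉q₁ ← first-occurrence c∈pre =
  ⊥-elim (nub-once asc no121 (trans eq (++-assoc q₁ (c ∷ q₂) _)) q₁≢[] c∉q₁ (∈-++⁺ʳ q₂ (here refl)))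
  where
  q₁≢[] : q₁ ≢ []
  q₁≢[] refl = c≢a (∷-injectiveˡ (sym eq))

tail-entry-nub : ∀ {a w q c r} → AscbotEqNub (a ∷ w) → ¬ Contains121 (a ∷ w) →
                 w ≡ q ++ c ∷ r → c ≢ a → c ∉ a ∷ q
tail-entry-nub asc no121 eq c≢a c∈ = c≢a (repeat-is-head asc no121 (cong (_ ∷_) eq) c∈)

head-is-max : ∀ {a w} → AscbotEqNub (a ∷ w) → maxW (a ∷ w) ≡ a
head-is-max {a} {w} asc with first-occurrence (maxW-∈ a w)
... | []     , _  , eq , _   = sym (∷-injectiveˡ eq)
... | x ∷ q₁ , q₂ , eq , m∉ with nub-ascends asc eq (λ ()) m∉
...   | head> {d} m<d =
  ⊥-elim (<⇒≱ m<d (maxW-ub (subst (d ∈_) (sym eq) (∈-++⁺ʳ (x ∷ q₁) (there (here refl))))))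

revisedAvoiding121⇒Blocks : ∀ {a w} → All (0 <_) w → RevisedAvoiding121 (a ∷ w) → Blocks a (oneTo (pred a)) 0 w
revisedAvoiding121⇒Blocks {a} {w} positive ((cayley , asc) , no121) = record
  { entry   = entry
  ; covers  = covers
  ; pending = λ ()
  ; ascends = λ q c r eq c≢a → nub-ascends asc (cong (a ∷_) eq) (λ ()) (tail-entry-nub asc no121 eq c≢a)
  ; once    = once
  }
  where
  max≡a : maxW (a ∷ w) ≡ a
  max≡a = head-is-max asc
  entry : ∀ {c} → c ∈ w → c ≡ a ⊎ c ∈ oneTo (pred a)
  entry {c} c∈w with c ≟ a
  ... | yes c≡a = inj₁ c≡a
  ... | no  c≢a = inj₂ (∈-oneTo-pred⁺ (All.lookup positive c∈w)
                         (≤∧≢⇒< (subst (c ≤_) max≡a (maxW-ub (there c∈w))) c≢a))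
  covers : ∀ {v} → v ∈ oneTo (pred a) → v ∈ w
  covers v∈ with 0<v , v<a ← ∈-oneTo-pred⁻ v∈
            with cayley (∈-oneTo⁺ 0<v (subst (_ ≤_) (sym max≡a) (<⇒≤ v<a)))
  ... | here v≡a  = ⊥-elim (<⇒≢ v<a v≡a)
  ... | there v∈w = v∈w
  once : ∀ q c r → w ≡ q ++ c ∷ r → c ≢ a → c ∉ q ++ r
  once q c r eq c≢a c∈ with ∈-++⁻ q c∈
  ... | inj₁ c∈q = tail-entry-nub asc no121 eq c≢a (there c∈q)
  ... | inj₂ c∈r = nub-once asc no121 (cong (a ∷_) eq) (λ ()) (tail-entry-nub asc no121 eq c≢a) c∈r

Blocks⇒revisedAvoiding121 : ∀ {a w} → Blocks a (oneTo (pred a)) 0 w → RevisedAvoiding121 (a ∷ w)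
Blocks⇒revisedAvoiding121 {a} {w} bl = (cayley , asc) , no121
  where
  open Blocks bl
  bounded : ∀ {c} → c ∈ a ∷ w → c ≤ a
  bounded (here refl) = ≤-refl
  bounded (there c∈w) with entry c∈w
  ... | inj₁ refl = ≤-refl
  ... | inj₂ c∈U  = <⇒≤ (proj₂ (∈-oneTo-pred⁻ c∈U))
  max≡a : maxW (a ∷ w) ≡ a
  max≡a = ≤-antisym (maxW-lub (a ∷ w) bounded) (maxW-ub {x = a ∷ w} (here refl))
  cayley : Cayley (a ∷ w)
  cayley {v} v∈ with ∈-oneTo⁻ v∈ | v ≟ a
  ... | _           | yes refl = here refl
  ... | 0<v , v≤max | no  v≢a  =
    there (covers (∈-oneTo-pred⁺ 0<v (≤∧≢⇒< (subst (v ≤_) max≡a v≤max) v≢a)))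
  asc : AscbotEqNub (a ∷ w)
  asc []      c post _ = refl
  asc (_ ∷ q) c post eq with refl , w≡ ← ∷-injective eq | c ≟ a
  ... | yes refl = trans (head-not-ascent post w≡) (cong not (sym (elem-true {a} {a ∷ q} (here refl))))
    where
    head-not-ascent : ∀ post → w ≡ q ++ a ∷ post → ascbotAt (a ∷ q) a post ≡ false
    head-not-ascent []      _  = refl
    head-not-ascent (d ∷ r) w≡ =
      <ᵇ-false (≤⇒≯ (bounded (there (subst (d ∈_) (sym w≡) (∈-++⁺ʳ q (there (here refl)))))))
  ... | no c≢a with ascends q c post w≡ c≢a
  ...   | head> c<d = trans (<ᵇ-true c<d) (cong not (sym (elem-false c∉)))
    where
    c∉ : c ∉ a ∷ q
    c∉ (here c≡a)  = c≢a c≡a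
    c∉ (there c∈q) = once q c post w≡ c≢a (∈-++⁺ˡ c∈q)
  no121 : ¬ Contains121 (a ∷ w)
  no121 (p , q , p<q , refl ∷ s) = <⇒≱ p<q (bounded (there (Any-resp-⊆ s (here refl))))
  no121 (p , q , p<q , .a ∷ʳ s) with w₁ , w₂ , refl , s′ ← ∷-⊆-split s =
    once w₁ p w₂ refl p≢a (∈-++⁺ʳ w₁ (Any-resp-⊆ s′ (there (here refl))))
    where
    p≢a : p ≢ a
    p≢a refl = <⇒≱ p<q (bounded (there (∈-++⁺ʳ w₁ (there (Any-resp-⊆ s′ (here refl))))))

revisedAvoiding121ᵇ≡blocksᵇ : ∀ {a w} → 0 < a → All (0 <_) w →
  revisedAvoiding121ᵇ (a ∷ w) ≡ blocksᵇ a (oneTo (pred a)) 0 w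
revisedAvoiding121ᵇ≡blocksᵇ {a} {w} 0<a positive = T-⇔⇒≡ (⇔-trans (revisedAvoiding121⇔ (a ∷ w))
  (⇔-trans (mk⇔ (revisedAvoiding121⇒Blocks positive) Blocks⇒revisedAvoiding121)
           (⇔-sym (blocksᵇ⇔Blocks w (valueSet-oneTo-pred a) 0<a))))

-- Counting

count : (List ℕ → Bool) → List (List ℕ) → ℕ
count f W = length (filter (λ w → T? (f w)) W)

count-cong : ∀ {f g} W → (∀ {w} → w ∈ W → f w ≡ g w) → count f W ≡ count g W
count-cong         []      _   = refl
count-cong {f} {g} (w ∷ W) f≡g with f w | g w | f≡g (here refl)
... | true  | true  | refl = cong suc (count-cong W (f≡g ∘ there))
... | false | false | refl = count-cong W (f≡g ∘ there)

count-false : ∀ W → count (λ _ → false) W ≡ 0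
count-false []      = refl
count-false (_ ∷ W) = count-false W

count-++ : ∀ f X Y → count f (X ++ Y) ≡ count f X + count f Y
count-++ f X Y = trans (cong length (filter-++ (λ w → T? (f w)) X Y)) (length-++ (filter (λ w → T? (f w)) X))

count-map-∷ : ∀ f (a : ℕ) W → count f (map (a ∷_) W) ≡ count (λ w → f (a ∷ w)) W
count-map-∷ f a []      = refl
count-map-∷ f a (w ∷ W) with f (a ∷ w)
... | true  = cong suc (count-map-∷ f a W)
... | false = count-map-∷ f a W

count-wordsOver-suc : ∀ f A L →
  count f (wordsOver A (suc L)) ≡ sum (map (λ c → count (λ w → f (c ∷ w)) (wordsOver A L)) A)
count-wordsOver-suc f A L = go A
  where
  go : ∀ B → count f (concatMap (λ c → map (c ∷_) (wordsOver A L)) B)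
           ≡ sum (map (λ c → count (λ w → f (c ∷ w)) (wordsOver A L)) B)
  go []      = refl
  go (c ∷ B) = trans (count-++ f (map (c ∷_) (wordsOver A L)) _) (cong₂ _+_ (count-map-∷ f c (wordsOver A L)) (go B))

sum-map-cong : ∀ {f g : ℕ → ℕ} xs → (∀ {c} → c ∈ xs → f c ≡ g c) → sum (map f xs) ≡ sum (map g xs)
sum-map-cong xs f≡g = cong sum (map-cong-local (All.tabulate f≡g))

sum-map-zero : ∀ {f : ℕ → ℕ} xs → (∀ {c} → c ∈ xs → f c ≡ 0) → sum (map f xs) ≡ 0
sum-map-zero []       _    = refl
sum-map-zero (x ∷ xs) f≡0 = cong₂ _+_ (f≡0 (here refl)) (sum-map-zero xs (f≡0 ∘ there))

sum-map-+ : ∀ (f g : ℕ → ℕ) xs → sum (map (λ c → f c + g c) xs) ≡ sum (map f xs) + sum (map g xs)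
sum-map-+ f g []       = refl
sum-map-+ f g (x ∷ xs) = trans (cong (f x + g x +_) (sum-map-+ f g xs)) (interchange (f x) (g x) _ _)
  where
  interchange : ∀ a b c d → a + b + (c + d) ≡ a + c + (b + d)
  interchange = solve-∀

sum-map-* : ∀ k (f : ℕ → ℕ) xs → sum (map (λ c → k * f c) xs) ≡ k * sum (map f xs)
sum-map-* k f []       = sym (*-zeroʳ k)
sum-map-* k f (x ∷ xs) = trans (cong (k * f x +_) (sum-map-* k f xs)) (sym (*-distribˡ-+ k (f x) _))

sum-restrict : ∀ (g : ℕ → ℕ) {A U} → AllPairs _<_ A → AllPairs _<_ U → (∀ {u} → u ∈ U → u ∈ A) →
               sum (map (λ c → if elem c U then g c else 0) A) ≡ sum (map g U)
sum-restrict g {[]}    {[]}    _ _ _ = refl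
sum-restrict g {[]}    {u ∷ U} _ _ U⊆A with () ← U⊆A (here refl)
sum-restrict g {a ∷ A} {[]}    _ _ _ = sum-map-zero (a ∷ A) (λ _ → refl)
sum-restrict g {a ∷ A} {u ∷ U} (a<A ∷ sortedA) (u<U ∷ sortedU) U⊆A with U⊆A (here refl)
... | here refl = cong₂ _+_ (cong (λ b → if b then g a else 0) (elem-true {a} {a ∷ U} (here refl)))
                            (trans (sum-map-cong A drop-a) (sum-restrict g sortedA sortedU U⊆A′))
  where
  drop-a : ∀ {c} → c ∈ A → (if elem c (a ∷ U) then g c else 0) ≡ (if elem c U then g c else 0)
  drop-a c∈A rewrite ≡ᵇ-false (≢-sym (<⇒≢ (All.lookup a<A c∈A))) = refl
  U⊆A′ : ∀ {v} → v ∈ U → v ∈ A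
  U⊆A′ v∈U with U⊆A (there v∈U)
  ... | here refl = ⊥-elim (n≮n _ (All.lookup u<U v∈U))
  ... | there v∈A = v∈A
... | there u∈A = trans (cong₂ _+_ a-absent refl) (sum-restrict g sortedA (u<U ∷ sortedU) uU⊆A)
  where
  a<uU : ∀ {v} → v ∈ u ∷ U → a < v
  a<uU (here refl) = All.lookup a<A u∈A
  a<uU (there v∈U) = <-trans (All.lookup a<A u∈A) (All.lookup u<U v∈U)
  a-absent : (if elem a (u ∷ U) then g a else 0) ≡ 0
  a-absent rewrite elem-false (λ a∈ → n≮n a (a<uU a∈)) = refl
  uU⊆A : ∀ {v} → v ∈ u ∷ U → v ∈ A
  uU⊆A v∈ with U⊆A v∈
  ... | here refl = ⊥-elim (n≮n _ (a<uU v∈))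
  ... | there v∈A = v∈A

-- Ways to put each u ∈ U into one of k blocks when block 1 only accepts values above b.
choices : ℕ → ℕ → List ℕ → ℕ
choices k b U = product (map (λ u → if b <ᵇ u then k else k ∸ 1) U)

sumAbove : ℕ → List ℕ → (ℕ → ℕ) → ℕ
sumAbove b U g = sum (map (λ s → if b <ᵇ s then g s else 0) U)

choices-above : ∀ k {b} U → All (b <_) U → choices k b U ≡ k ^ length U
choices-above k []      []          = refl
choices-above k (u ∷ U) (b<u ∷ b<U) rewrite <ᵇ-true b<u = cong (k *_) (choices-above k U b<U)

-- Those placements of U into k + 1 blocks in which s is the least element of block 1.
withFirstMin : ℕ → List ℕ → ℕ → ℕ
withFirstMin k U s = choices (suc k) s (U without s)

withFirstMin-head : ∀ k {u U} → All (u <_) U → withFirstMin k (u ∷ U) u ≡ choices (suc k) u U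
withFirstMin-head k {u} {U} u<U = cong (choices (suc k) u) (without-head U u<U)

sumAbove-withFirstMin-∷ : ∀ k b {u U} → All (u <_) U →
  sumAbove b U (withFirstMin k (u ∷ U)) ≡ k * sumAbove b U (withFirstMin k U)
sumAbove-withFirstMin-∷ k b {u} {U} u<U =
  trans (sum-map-cong U pointwise) (sum-map-* k (λ s → if b <ᵇ s then withFirstMin k U s else 0) U)
  where
  pointwise : ∀ {s} → s ∈ U → (if b <ᵇ s then withFirstMin k (u ∷ U) s else 0)
                             ≡ k * (if b <ᵇ s then withFirstMin k U s else 0)
  pointwise {s} s∈U with b <ᵇ s
  ... | false = sym (*-zeroʳ k)
  ... | true  = trans (cong (choices (suc k) s) (without-∷ U (<⇒≢ u<s)))
                      (cong (λ t → (if t then suc k else k) * withFirstMin k U s) (<ᵇ-false (<⇒≯ u<s)))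
    where
    u<s = All.lookup u<U s∈U

-- Block 1 is either empty or has a least element s > b.
choices-suc : ∀ k b U → AllPairs _<_ U →
  choices (suc k) b U ≡ k ^ length U + sumAbove b U (withFirstMin k U)
choices-suc k b []      []             = refl
choices-suc k b (u ∷ U) (u<U ∷ sorted) with b <ᵇ u | <ᵇ-reflects-< b u
... | false | ofⁿ _ = begin
  k * choices (suc k) b U                         ≡⟨ cong (k *_) (choices-suc k b U sorted) ⟩
  k * (P + sumAbove b U (withFirstMin k U))       ≡⟨ *-distribˡ-+ k P _ ⟩
  k * P + k * sumAbove b U (withFirstMin k U)     ≡⟨ cong (k * P +_) (sumAbove-withFirstMin-∷ k b u<U) ⟨
  k * P + sumAbove b U (withFirstMin k (u ∷ U))   ∎
  where
  P = k ^ length U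
... | true | ofʸ b<u = begin
  suc k * choices (suc k) b U
    ≡⟨ cong (suc k *_) (trans (choices-above (suc k) U b<U) (sym (choices-above (suc k) U u<U))) ⟩
  suc k * C
    ≡⟨ cong (λ n → C + k * n) (choices-suc k u U sorted) ⟩
  C + k * (P + S u)
    ≡⟨ rearrange C k P (S u) ⟩
  k * P + (C + k * S u)
    ≡⟨ cong (λ n → k * P + (C + k * n)) (sum-map-cong U same-threshold) ⟩
  k * P + (C + k * S b)
    ≡⟨ cong₂ (λ m n → k * P + (m + n)) (withFirstMin-head k u<U) (sumAbove-withFirstMin-∷ k b u<U) ⟨
  k * P + (withFirstMin k (u ∷ U) u + sumAbove b U (withFirstMin k (u ∷ U))) ∎
  where
  P = k ^ length U
  C = choices (suc k) u U
  S : ℕ → ℕ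
  S b′ = sumAbove b′ U (withFirstMin k U)
  b<U : All (b <_) U
  b<U = All.map (<-trans b<u) u<U
  rearrange : ∀ c k p s → c + k * (p + s) ≡ k * p + (c + k * s)
  rearrange = solve-∀
  same-threshold : ∀ {s} → s ∈ U → (if u <ᵇ s then withFirstMin k U s else 0)
                                 ≡ (if b <ᵇ s then withFirstMin k U s else 0)
  same-threshold s∈U rewrite <ᵇ-true (All.lookup u<U s∈U) | <ᵇ-true (All.lookup b<U s∈U) = refl

truncated-power-zero : ∀ {m n} → m ≤ n → 0 < n → (m ∸ n) ^ n ≡ 0
truncated-power-zero {m} {suc n} m≤n _ rewrite m≤n⇒m∸n≡0 m≤n = refl

-- The number of accepted words of length L: they consist of U and k = L ∸ length U letters M,
-- and an open run (b > 0) still needs an M to close it.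

blockCount : List ℕ → ℕ → ℕ → ℕ
blockCount U zero    L = (L ∸ length U) ^ length U
blockCount U (suc b) L = if length U <ᵇ L then choices (L ∸ length U) (suc b) U else 0

blockCount-suc : ∀ {U} b L → AllPairs _<_ U → All (0 <_) U →
  blockCount U b (suc L) ≡ blockCount U 0 L + sumAbove b U (λ s → blockCount (U without s) s L)
blockCount-suc {U} b L sorted positive with length U ≤? L
... | yes |U|≤L = begin
  blockCount U b (suc L)                          ≡⟨ enough-letters b ⟩
  choices (suc k) b U                             ≡⟨ choices-suc k b U sorted ⟩
  k ^ length U + sumAbove b U (withFirstMin k U)  ≡⟨ cong (k ^ length U +_) (sum-map-cong U pointwise) ⟩
  k ^ length U + sumAbove b U (λ s → blockCount (U without s) s L) ∎
  where
  k = L ∸ length U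
  suc-k : suc L ∸ length U ≡ suc k
  suc-k = +-∸-assoc 1 |U|≤L
  enough-letters : ∀ b → blockCount U b (suc L) ≡ choices (suc k) b U
  enough-letters zero    rewrite suc-k = sym (choices-above (suc k) U positive)
  enough-letters (suc b) rewrite <ᵇ-true (s≤s |U|≤L) | suc-k = refl
  pointwise : ∀ {s} → s ∈ U → (if b <ᵇ s then withFirstMin k U s else 0)
                            ≡ (if b <ᵇ s then blockCount (U without s) s L else 0)
  pointwise {s} s∈U with All.lookup positive s∈U
  ... | z<s {s′} rewrite sym (length-without U sorted s∈U)
                       | <ᵇ-true {length (U without s)} |U|≤L
                       | +-∸-assoc 1 |U|≤L = refl
... | no |U|≰L = begin
  blockCount U b (suc L)
    ≡⟨ too-few-letters b ⟩
  0
    ≡⟨ cong₂ _+_ (truncated-power-zero (≤-trans (n≤1+n L) L<|U|) 0<|U|) (sum-map-zero U pointwise) ⟨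
  blockCount U 0 L + sumAbove b U (λ s → blockCount (U without s) s L) ∎
  where
  L<|U| : suc L ≤ length U
  L<|U| = ≰⇒> |U|≰L
  0<|U| : 0 < length U
  0<|U| = <-≤-trans z<s L<|U|
  too-few-letters : ∀ b → blockCount U b (suc L) ≡ 0
  too-few-letters zero    = truncated-power-zero L<|U| 0<|U|
  too-few-letters (suc b) rewrite <ᵇ-false (<⇒≱ (s≤s L<|U|)) = refl
  pointwise : ∀ {s} → s ∈ U → (if b <ᵇ s then blockCount (U without s) s L else 0) ≡ 0
  pointwise {s} s∈U with b <ᵇ s | All.lookup positive s∈U
  ... | false | _ = refl
  ... | true  | z<s rewrite <ᵇ-false {length (U without s)} {L}
                              (<⇒≱ (subst (suc L ≤_) (sym (length-without U sorted s∈U)) L<|U|)) = refl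

module Counting (A : List ℕ) (sortedA : AllPairs _<_ A) (M : ℕ) (M∈A : M ∈ A) where

  accepted : List ℕ → ℕ → ℕ → ℕ
  accepted U b L = count (blocksᵇ M U b) (wordsOver A L)

  accepted-zero : ∀ U b → accepted U b 0 ≡ blockCount U b 0
  accepted-zero []      zero    = refl
  accepted-zero (_ ∷ _) zero    = refl
  accepted-zero []      (suc _) = refl
  accepted-zero (_ ∷ _) (suc _) = refl

  accepted-suc : ∀ {U} b L → ValueSet M U → (∀ {u} → u ∈ U → u ∈ A) →
                 accepted U b (suc L) ≡ accepted U 0 L + sumAbove b U (λ s → accepted (U without s) s L)
  accepted-suc {U} b L vs U⊆A = begin
    accepted U b (suc L)
      ≡⟨ count-wordsOver-suc (blocksᵇ M U b) A L ⟩
    sum (map (λ c → count (λ w → blocksᵇ M U b (c ∷ w)) (wordsOver A L)) A)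
      ≡⟨ sum-map-cong A (λ {c} _ → first-letter c) ⟩
    sum (map (λ c → (if elem c (M ∷ []) then accepted U 0 L else 0) + (if elem c U then next c else 0)) A)
      ≡⟨ sum-map-+ _ _ A ⟩
    sum (map (λ c → if elem c (M ∷ []) then accepted U 0 L else 0) A)
      + sum (map (λ c → if elem c U then next c else 0) A)
      ≡⟨ cong₂ _+_ (sum-restrict (λ _ → accepted U 0 L) sortedA ([] ∷ []) (λ { (here refl) → M∈A }))
                   (sum-restrict next sortedA (ValueSet.sorted vs) U⊆A) ⟩
    accepted U 0 L + 0 + sumAbove b U (λ s → accepted (U without s) s L)
      ≡⟨ cong (_+ sumAbove b U (λ s → accepted (U without s) s L)) (+-identityʳ (accepted U 0 L)) ⟩
    accepted U 0 L + sumAbove b U (λ s → accepted (U without s) s L) ∎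
    where
    next : ℕ → ℕ
    next c = if b <ᵇ c then accepted (U without c) c L else 0
    -- The indicator of c ≡ M is membership in M ∷ [], so that `sum-restrict` evaluates both sums.
    first-letter : ∀ c → count (λ w → blocksᵇ M U b (c ∷ w)) (wordsOver A L)
                       ≡ (if elem c (M ∷ []) then accepted U 0 L else 0) + (if elem c U then next c else 0)
    first-letter c with c ≡ᵇ M | ≡ᵇ-reflects-≡ c M
    ... | true  | ofʸ refl rewrite elem-false (λ M∈U → n≮n M (All.lookup (ValueSet.below vs) M∈U)) =
      sym (+-identityʳ _)
    ... | false | ofⁿ _ with b <ᵇ c | elem c U
    ...   | true  | true  = refl
    ...   | true  | false = count-false (wordsOver A L)
    ...   | false | true  = count-false (wordsOver A L)
    ...   | false | false = count-false (wordsOver A L)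

  accepted≡blockCount : ∀ L {U b} → ValueSet M U → (∀ {u} → u ∈ U → u ∈ A) →
                        accepted U b L ≡ blockCount U b L
  accepted≡blockCount zero    {U} {b} _  _   = accepted-zero U b
  accepted≡blockCount (suc L) {U} {b} vs U⊆A = begin
    accepted U b (suc L)
      ≡⟨ accepted-suc b L vs U⊆A ⟩
    accepted U 0 L + sumAbove b U (λ s → accepted (U without s) s L)
      ≡⟨ cong₂ _+_ (accepted≡blockCount L vs U⊆A) (sum-map-cong U ih) ⟩
    blockCount U 0 L + sumAbove b U (λ s → blockCount (U without s) s L)
      ≡⟨ blockCount-suc b L (ValueSet.sorted vs) (ValueSet.positive vs) ⟨
    blockCount U b (suc L) ∎
    where
    ih : ∀ {s} → s ∈ U → (if b <ᵇ s then accepted (U without s) s L else 0)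
                       ≡ (if b <ᵇ s then blockCount (U without s) s L else 0)
    ih {s} _ = cong (λ n → if b <ᵇ s then n else 0)
                    (accepted≡blockCount L (valueSet-without s vs) (U⊆A ∘ proj₁ ∘ ∈-without⁻ U))

count-with-head : ∀ n m {a} → a ∈ oneTo n →
  count (λ w → revisedAvoiding121ᵇ (a ∷ w)) (wordsOver (oneTo n) m) ≡ (m ∸ pred a) ^ pred a
count-with-head n m {a} a∈ = begin
  count (λ w → revisedAvoiding121ᵇ (a ∷ w)) (wordsOver (oneTo n) m)
    ≡⟨ count-cong (wordsOver (oneTo n) m)
                  (λ w∈ → revisedAvoiding121ᵇ≡blocksᵇ 0<a (All.map (proj₁ ∘ ∈-oneTo⁻) (∈-wordsOver⁻ m w∈))) ⟩
  accepted (oneTo (pred a)) 0 m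
    ≡⟨ accepted≡blockCount m (valueSet-oneTo-pred a) U⊆A ⟩
  (m ∸ length (oneTo (pred a))) ^ length (oneTo (pred a))
    ≡⟨ cong (λ l → (m ∸ l) ^ l) (length-applyUpTo suc (pred a)) ⟩
  (m ∸ pred a) ^ pred a ∎
  where
  open Counting (oneTo n) (oneTo-sorted n) a a∈
  0<a : 0 < a
  0<a = proj₁ (∈-oneTo⁻ a∈)
  U⊆A : ∀ {v} → v ∈ oneTo (pred a) → v ∈ oneTo n
  U⊆A v∈ with 0<v , v<a ← ∈-oneTo-pred⁻ v∈ =
    ∈-oneTo⁺ 0<v (≤-trans (<⇒≤ v<a) (proj₂ (∈-oneTo⁻ a∈)))

applyUpTo-cong : ∀ n {f g : ℕ → ℕ} → (∀ {i} → i < n → f i ≡ g i) → applyUpTo f n ≡ applyUpTo g n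
applyUpTo-cong zero    _   = refl
applyUpTo-cong (suc n) f≡g = cong₂ _∷_ (f≡g z<s) (applyUpTo-cong n (f≡g ∘ s<s))

sum-applyUpTo-reverse : ∀ n (f : ℕ → ℕ) → sum (applyUpTo f n) ≡ sum (applyUpTo (λ i → f (n ∸ suc i)) n)
sum-applyUpTo-reverse zero    f = refl
sum-applyUpTo-reverse (suc n) f = begin
  sum (applyUpTo f (suc n))                          ≡⟨ cong sum (applyUpTo-∷ʳ f n) ⟨
  sum (applyUpTo f n ++ f n ∷ [])                    ≡⟨ sum-++ (applyUpTo f n) (f n ∷ []) ⟩
  sum (applyUpTo f n) + (f n + 0)                    ≡⟨ +-comm _ (f n + 0) ⟩
  f n + 0 + sum (applyUpTo f n)                      ≡⟨ cong₂ _+_ (+-identityʳ (f n)) (sum-applyUpTo-reverse n f) ⟩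
  f n + sum (applyUpTo (λ i → f (n ∸ suc i)) n)      ∎

sum-powers-reindex : ∀ m → 0 < m → sum (map (λ a → (m ∸ pred a) ^ pred a) (oneTo (suc m))) ≡ rhs (suc m)
sum-powers-reindex m 0<m = begin
  sum (map (λ a → (m ∸ pred a) ^ pred a) (oneTo (suc m)))
    ≡⟨ cong sum (map-applyUpTo suc (λ a → (m ∸ pred a) ^ pred a) (suc m)) ⟩
  sum (applyUpTo (λ i → (m ∸ i) ^ i) (suc m))
    ≡⟨ sum-applyUpTo-reverse (suc m) (λ i → (m ∸ i) ^ i) ⟩
  (m ∸ m) ^ m + sum (applyUpTo (λ i → (m ∸ (m ∸ suc i)) ^ (m ∸ suc i)) m)
    ≡⟨ cong₂ _+_ (truncated-power-zero ≤-refl 0<m) (cong sum (applyUpTo-cong m exponent)) ⟩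
  0 + sum (applyUpTo (λ i → suc i ^ (m ∸ i ∸ 1)) m) ∎
  where
  exponent : ∀ {i} → i < m → (m ∸ (m ∸ suc i)) ^ (m ∸ suc i) ≡ suc i ^ (m ∸ i ∸ 1)
  exponent {i} i<m = cong₂ _^_ (m∸[m∸n]≡n i<m) (trans (cong (m ∸_) (+-comm 1 i)) (sym (∸-+-assoc m i 1)))

mainTheorem10 : (n : ℕ) → 2 ≤ n → length (hatB n (1 ∷ 2 ∷ 1 ∷ [])) ≡ rhs n
mainTheorem10 (suc m) (s≤s 0<m) = begin
  length (hatB (suc m) σ121)
    ≡⟨ count-wordsOver-suc revisedAvoiding121ᵇ (oneTo (suc m)) m ⟩
  sum (map (λ a → count (λ w → revisedAvoiding121ᵇ (a ∷ w)) (wordsOver (oneTo (suc m)) m)) (oneTo (suc m)))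
    ≡⟨ sum-map-cong (oneTo (suc m)) (count-with-head (suc m) m) ⟩
  sum (map (λ a → (m ∸ pred a) ^ pred a) (oneTo (suc m)))
    ≡⟨ sum-powers-reindex m 0<m ⟩
  rhs (suc m) ∎
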